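{- Let $G$ be a connected graph and $e\in E(G)$ an edge such that $G-e$ is connected. (i) $\mu_t(G-e)\le \mu_t(G)+2$, and this inequality is sharp (there exist such $G$ and $e$ with $\mu_t(G-e)=\mu_t(G)+2$). (ii) There are no constants $a>0$ and $b$ such that $a\cdot\mu_t(G)+b\le \mu_t(G-e)$ holds for every connected graph $G$ and every edge $e\in E(G)$ with $G-e$ connected.
   Context: All graphs are finite, simple and connected. For a connected graph $G$ and $X\subseteq V(G)$, two vertices $u,v$ are $X$-visible if there is a shortest $u,v$-path $P$ in $G$ with $V(P)\cap X\subseteq\{u,v\}$. A set $X\subseteq V(G)$ is a total mutual-visibility set if every two vertices $u,v\in V(G)$ are $X$-visible; the total mutual-visibility number $\mu_t(G)$ is the maximum cardinality of a total mutual-visibility set in $G$. $G-e$ denotes the graph obtained by deleting the edge $e$.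
   Formalization: In part (ii) the constants $a>0$ and $b$ are taken in the rationals. -}

module Defs where

open import Data.Bool using (Bool; true; false; _∧_; _∨_; not)
open import Data.Nat using (ℕ; zero; suc; _≤_; _+_)
open import Data.Fin using (Fin)
open import Data.Fin.Properties using (_≟_)
open import Data.Fin.Subset using (Subset; _∈_; ∣_∣)
open import Data.List using (List; []; _∷_)
open import Data.List.Membership.Propositional using () renaming (_∈_ to _∈ₗ_)
open import Data.Product using (Σ; _×_; _,_)
open import Data.Sum using (_⊎_)
open import Relation.Binary.PropositionalEquality using (_≡_; refl; sym; trans)
open import Relation.Nullary.Decidable using (⌊_⌋)

record Graph (n : ℕ) : Set where
  field
    adj    : Fin n → Fin n → Bool
    adj-sym    : ∀ u v → adj u v ≡ adj v u
    adj-irrefl : ∀ u → adj u u ≡ false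
open Graph public

data Walk {n : ℕ} (G : Graph n) : Fin n → Fin n → Set where
  nil  : ∀ u → Walk G u u
  cons : ∀ {u w v} → adj G u w ≡ true → Walk G w v → Walk G u v

len : ∀ {n} {G : Graph n} {u v} → Walk G u v → ℕ
len (nil _) = 0
len (cons _ p) = suc (len p)

verts : ∀ {n} {G : Graph n} {u v} → Walk G u v → List (Fin n)
verts (nil u) = u ∷ []
verts (cons {u = u} _ p) = u ∷ verts p

Connected : ∀ {n} → Graph n → Set
Connected G = ∀ u v → Walk G u v

-- a shortest u,v-walk (necessarily a path)
IsShortest : ∀ {n} {G : Graph n} {u v} → Walk G u v → Set
IsShortest {G = G} {u} {v} p = ∀ (q : Walk G u v) → len p ≤ len q

Visible : ∀ {n} (G : Graph n) (X : Subset n) (u v : Fin n) → Set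
Visible G X u v =
  Σ (Walk G u v) λ P → IsShortest P ×
    (∀ x → x ∈ₗ verts P → x ∈ X → (x ≡ u ⊎ x ≡ v))

IsTotalMutualVisibility : ∀ {n} (G : Graph n) (X : Subset n) → Set
IsTotalMutualVisibility G X = ∀ u v → Visible G X u v

IsMuT : ∀ {n} (G : Graph n) (k : ℕ) → Set
IsMuT G k =
  (Σ (Subset _) λ X → IsTotalMutualVisibility G X × ∣ X ∣ ≡ k) ×
  (∀ X → IsTotalMutualVisibility G X → ∣ X ∣ ≤ k)

_-edge_,_ : ∀ {n} → Graph n → Fin n → Fin n → Graph n
_-edge_,_ {n} G a b = record
  { adj = λ x y → adj G x y ∧ not (isE x y)
  ; adj-sym = λ x y → lemma x y
  ; adj-irrefl = λ x → irr x }
  where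
  isE : Fin n → Fin n → Bool
  isE x y = (⌊ x ≟ a ⌋ ∧ ⌊ y ≟ b ⌋) ∨ (⌊ x ≟ b ⌋ ∧ ⌊ y ≟ a ⌋)
  open import Data.Bool.Properties using (∧-comm; ∨-comm)
  open import Relation.Binary.PropositionalEquality using (cong; cong₂)
  isE-sym : ∀ x y → isE x y ≡ isE y x
  isE-sym x y = trans (∨-comm (⌊ x ≟ a ⌋ ∧ ⌊ y ≟ b ⌋) _)
    (cong₂ _∨_ (∧-comm ⌊ x ≟ b ⌋ _) (∧-comm ⌊ x ≟ a ⌋ _))
  lemma : ∀ x y → (adj G x y ∧ not (isE x y)) ≡ (adj G y x ∧ not (isE y x))
  lemma x y = cong₂ _∧_ (adj-sym G x y) (cong not (isE-sym x y))
  irr : ∀ x → (adj G x x ∧ not (isE x x)) ≡ false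
  irr x rewrite adj-irrefl G x = refl

-- If X is a total mutual-visibility set of G − ab, then X ∖ {a, b} is one of G. Take a geodesic P
-- of G from u to v. If P avoids ab, a geodesic of G − ab witnessing the X-visibility of u, v is
-- also a geodesic of G. Otherwise P crosses ab exactly once, say from s to t, and the X-visible
-- geodesics u → s and t → v of G − ab joined by st form a geodesic of G whose only possible
-- interior vertices in X are s and t, both removed. Hence μt(G − e) ≤ μt(G) + 2, with equality
-- for C₅ and P₅. In the book graph of m ≥ 2 four-cycles A Xᵢ Yᵢ B glued along AB, the 2m page
-- vertices are a maximum total mutual-visibility set, while after deleting AB every vertex is
-- the unique middle vertex of a geodesic of length 2, so μt = 0; a bound α μt(G) + β ≤ μt(G − e)
-- with α > 0 would give 2αm + β ≤ 0 for all m.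

module Submission where

open import Defs
open import Data.Bool using (Bool; true; false; _∧_; _∨_; not)
import Data.Bool as Bool
open import Data.Bool.Properties using (∧-comm; ∧-conicalˡ; ∧-conicalʳ; ∨-comm; T-≡)
open import Data.Nat using (ℕ; zero; suc; _≤_; _<_; _+_; _*_; _∸_; z≤n; s≤s; _≡ᵇ_; _%_; _⊓_)
import Data.Nat as ℕ
open import Data.Nat.Properties
  using (≤-refl; ≤-reflexive; ≤-trans; ≤-<-trans; <-≤-trans; <⇒≤; <⇒≱; +-assoc; +-suc; +-identityʳ; *-identityʳ;
         +-mono-≤; +-monoˡ-≤; +-monoʳ-≤; +-monoˡ-<; m≤m+n; m<m+n; n≤1+n; m≤m*n; m≤n*m; m<n⇒0<n∸m;
         suc-injective; module ≤-Reasoning)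
open import Data.Fin using (Fin; zero; suc; toℕ; #_; splitAt; join; _↑ˡ_; _↑ʳ_)
open import Data.Fin.Properties using (_≟_; all?; any?; splitAt-↑ˡ; splitAt-↑ʳ; join-splitAt)
open import Data.Fin.Subset using (Subset; _∈_; _∉_; ∣_∣; inside; outside; ⊥; ⊤; _⊆_; _─_; _-_; ⁅_⁆)
open import Data.Fin.Subset.Properties
  using (_∈?_; x∈⁅x⁆; ∣⁅x⁆∣≡1; p─q⊆p; p⊆q⇒∣p∣≤∣q∣; ∉⊥; ∈⊤; ∣⊤∣≡n; ∣⊥∣≡0)
open import Data.Vec using ([]; _∷_; there)
open import Data.List using (_∷_)
open import Data.List.Membership.Propositional using () renaming (_∈_ to _∈ₗ_)
import Data.List.Relation.Unary.Any as Any
open import Data.Integer using (ℤ; +_; +[1+_]; -[1+_]; +≤+; +<+)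
  renaming (∣_∣ to ∣_∣ᶻ; _*_ to _*ℤ_; _+_ to _+ℤ_; _≤_ to _≤ℤ_)
import Data.Integer.Properties as ℤ
open import Data.Integer.GCD using () renaming (gcd to gcdℤ)
open import Data.Nat.GCD using (gcd-zeroʳ)
open import Data.Rational using (ℚ; 0ℚ; _/_; mkℚ; toℚᵘ; ↥_; ↧_; ↧ₙ_; *<*)
  renaming (_≤_ to _≤ℚ_; _<_ to _<ℚ_; _+_ to _+ℚ_; _*_ to _*ℚ_)
import Data.Rational.Properties as ℚ
import Data.Rational.Unnormalised as ℚᵘ
import Data.Rational.Unnormalised.Properties as ℚᵘₚ
open import Data.Product using (Σ; Σ-syntax; ∃-syntax; _×_; _,_; proj₁; proj₂)
open import Data.Sum using (_⊎_; inj₁; inj₂; [_,_]′)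
open import Data.Empty using (⊥-elim) renaming (⊥ to Empty)
open import Function using (_∘_; Equivalence)
open import Relation.Nullary using (¬_; Dec; yes; no; ¬?)
open import Relation.Nullary.Decidable using (⌊_⌋; toWitness; from-yes; map′; _×-dec_; _→-dec_)
open import Relation.Binary.PropositionalEquality

x∈p─q⇒x∉q : ∀ {n} {x : Fin n} (p q : Subset n) → x ∈ p ─ q → x ∉ q
x∈p─q⇒x∉q (_ ∷ p) (inside  ∷ q) (there x∈p─q) (there x∈q) = x∈p─q⇒x∉q p q x∈p─q x∈q
x∈p─q⇒x∉q (_ ∷ p) (outside ∷ q) (there x∈p─q) (there x∈q) = x∈p─q⇒x∉q p q x∈p─q x∈q

x∉p-x : ∀ {n} (p : Subset n) x → x ∉ p - x
x∉p-x p x x∈p-x = x∈p─q⇒x∉q p ⁅ x ⁆ x∈p-x (x∈⁅x⁆ x)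

∣p∣≤∣p─q∣+∣q∣ : ∀ {n} (p q : Subset n) → ∣ p ∣ ≤ ∣ p ─ q ∣ + ∣ q ∣
∣p∣≤∣p─q∣+∣q∣ []            []            = z≤n
∣p∣≤∣p─q∣+∣q∣ (outside ∷ p) (outside ∷ q) = ∣p∣≤∣p─q∣+∣q∣ p q
∣p∣≤∣p─q∣+∣q∣ (inside  ∷ p) (outside ∷ q) = s≤s (∣p∣≤∣p─q∣+∣q∣ p q)
∣p∣≤∣p─q∣+∣q∣ (outside ∷ p) (inside  ∷ q) =
  ≤-trans (∣p∣≤∣p─q∣+∣q∣ p q) (≤-trans (n≤1+n _) (≤-reflexive (sym (+-suc ∣ p ─ q ∣ ∣ q ∣))))
∣p∣≤∣p─q∣+∣q∣ (inside  ∷ p) (inside  ∷ q) =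
  ≤-trans (s≤s (∣p∣≤∣p─q∣+∣q∣ p q)) (≤-reflexive (sym (+-suc ∣ p ─ q ∣ ∣ q ∣)))

∣p∣≤∣p-x∣+1 : ∀ {n} (p : Subset n) x → ∣ p ∣ ≤ ∣ p - x ∣ + 1
∣p∣≤∣p-x∣+1 p x = subst (λ k → ∣ p ∣ ≤ ∣ p - x ∣ + k) (∣⁅x⁆∣≡1 x) (∣p∣≤∣p─q∣+∣q∣ p ⁅ x ⁆)

InternallyAvoids : ∀ {n} {G : Graph n} → Subset n → ∀ {u v} → Walk G u v → Set
InternallyAvoids X {u} {v} P = ∀ x → x ∈ₗ verts P → x ∈ X → x ≡ u ⊎ x ≡ v

HasGeodesics : ∀ {n} → Graph n → Set
HasGeodesics G = ∀ u v → Σ (Walk G u v) IsShortest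

tmv⇒hasGeodesics : ∀ {n} {G : Graph n} {X} → IsTotalMutualVisibility G X → HasGeodesics G
tmv⇒hasGeodesics tmv u v = let P , P-shortest , _ = tmv u v in P , P-shortest

isMuT⇒connected : ∀ {n} {G : Graph n} {k} → IsMuT G k → Connected G
isMuT⇒connected ((_ , tmv , _) , _) u v = proj₁ (tmv u v)

module _ {n} {G : Graph n} where

  infixr 5 _++ʷ_
  _++ʷ_ : ∀ {u w v} → Walk G u w → Walk G w v → Walk G u v
  nil _    ++ʷ Q = Q
  cons h P ++ʷ Q = cons h (P ++ʷ Q)

  len-++ʷ : ∀ {u w v} (P : Walk G u w) (Q : Walk G w v) → len (P ++ʷ Q) ≡ len P + len Q
  len-++ʷ (nil _)    Q = refl
  len-++ʷ (cons h P) Q = cong suc (len-++ʷ P Q)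

  ∈-verts-++ʷ⁻ : ∀ {u w v x} (P : Walk G u w) (Q : Walk G w v) →
                 x ∈ₗ verts (P ++ʷ Q) → x ∈ₗ verts P ⊎ x ∈ₗ verts Q
  ∈-verts-++ʷ⁻ (nil _)    Q x∈           = inj₂ x∈
  ∈-verts-++ʷ⁻ (cons h P) Q (Any.here e) = inj₁ (Any.here e)
  ∈-verts-++ʷ⁻ (cons h P) Q (Any.there x∈) with ∈-verts-++ʷ⁻ P Q x∈
  ... | inj₁ x∈P = inj₁ (Any.there x∈P)
  ... | inj₂ x∈Q = inj₂ x∈Q

  avoids-++ʷ : ∀ {X u w v} {P : Walk G u w} {Q : Walk G w v} →
               w ∉ X → InternallyAvoids X P → InternallyAvoids X Q → InternallyAvoids X (P ++ʷ Q)
  avoids-++ʷ {P = P} {Q} w∉X P-avoids Q-avoids x x∈ x∈X with ∈-verts-++ʷ⁻ P Q x∈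
  ... | inj₁ x∈P with P-avoids x x∈P x∈X
  ...   | inj₁ x≡u  = inj₁ x≡u
  ...   | inj₂ refl = ⊥-elim (w∉X x∈X)
  avoids-++ʷ {P = P} {Q} w∉X P-avoids Q-avoids x x∈ x∈X | inj₂ x∈Q with Q-avoids x x∈Q x∈X
  ...   | inj₁ refl = ⊥-elim (w∉X x∈X)
  ...   | inj₂ x≡v  = inj₂ x≡v

  avoids-⊆ : ∀ {X Y u v} {P : Walk G u v} → Y ⊆ X → InternallyAvoids X P → InternallyAvoids Y P
  avoids-⊆ Y⊆X P-avoids x x∈P x∈Y = P-avoids x x∈P (Y⊆X x∈Y)

module _ {n} (G : Graph n) where

  avoids-nil : ∀ {X} u → InternallyAvoids X (nil {G = G} u)
  avoids-nil u x (Any.here x≡u) _ = inj₁ x≡u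

  avoids-edge : ∀ {X u v} (h : adj G u v ≡ true) → InternallyAvoids {G = G} X (cons h (nil v))
  avoids-edge h x (Any.here x≡u)            _ = inj₁ x≡u
  avoids-edge h x (Any.there (Any.here x≡v)) _ = inj₂ x≡v

  avoids-cons : ∀ {X u w v} (h : adj G u w ≡ true) (Q : Walk G w v) →
                (w ∈ X → w ≡ v) → InternallyAvoids X Q → InternallyAvoids {G = G} X (cons h Q)
  avoids-cons h Q w-ok Q-avoids x (Any.here x≡u)   _   = inj₁ x≡u
  avoids-cons h Q w-ok Q-avoids x (Any.there x∈Q) x∈X with Q-avoids x x∈Q x∈X
  ... | inj₁ refl = inj₂ (w-ok x∈X)
  ... | inj₂ x≡v  = inj₂ x≡v

module _ {n} {G G′ : Graph n} (G⊆G′ : ∀ {x y} → adj G x y ≡ true → adj G′ x y ≡ true) where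

  mapʷ : ∀ {u v} → Walk G u v → Walk G′ u v
  mapʷ (nil u)    = nil u
  mapʷ (cons h P) = cons (G⊆G′ h) (mapʷ P)

  len-mapʷ : ∀ {u v} (P : Walk G u v) → len (mapʷ P) ≡ len P
  len-mapʷ (nil u)    = refl
  len-mapʷ (cons h P) = cong suc (len-mapʷ P)

  verts-mapʷ : ∀ {u v} (P : Walk G u v) → verts (mapʷ P) ≡ verts P
  verts-mapʷ (nil u)    = refl
  verts-mapʷ (cons h P) = cong (_ ∷_) (verts-mapʷ P)

  avoids-mapʷ : ∀ {X u v} {P : Walk G u v} → InternallyAvoids X P → InternallyAvoids X (mapʷ P)
  avoids-mapʷ {P = P} P-avoids x x∈ = P-avoids x (subst (x ∈ₗ_) (verts-mapʷ P) x∈)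

adj⇒≢ : ∀ {n} (G : Graph n) {x y} → adj G x y ≡ true → x ≢ y
adj⇒≢ G {x} h refl with trans (sym h) (adj-irrefl G x)
... | ()

module _ {n} {G : Graph n} where

  IsPotential : (Fin n → ℕ) → Set
  IsPotential f = ∀ x y → adj G x y ≡ true → f x ≤ suc (f y)

  potential≤len : ∀ {f} → IsPotential f → ∀ {u v} (R : Walk G u v) → f u ≤ len R + f v
  potential≤len f-pot (nil _)            = ≤-refl
  potential≤len f-pot (cons {u} {w} h R) = ≤-trans (f-pot u w h) (s≤s (potential≤len f-pot R))

module _ {n} (G : Graph n) where

  ≢⇒1≤len : ∀ {u v} → u ≢ v → (R : Walk G u v) → 1 ≤ len R
  ≢⇒1≤len u≢v (nil _)    = ⊥-elim (u≢v refl)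
  ≢⇒1≤len u≢v (cons _ _) = s≤s z≤n

  nonadjacent⇒2≤len : ∀ {u v} → u ≢ v → adj G u v ≡ false → (R : Walk G u v) → 2 ≤ len R
  nonadjacent⇒2≤len u≢v uv∉G (nil _)                     = ⊥-elim (u≢v refl)
  nonadjacent⇒2≤len u≢v uv∉G (cons h (nil _))            with trans (sym h) uv∉G
  ... | ()
  nonadjacent⇒2≤len u≢v uv∉G (cons _ (cons _ _))         = s≤s (s≤s z≤n)

  noCommonNeighbour⇒3≤len : ∀ {u v} → u ≢ v → adj G u v ≡ false →
    (∀ w → adj G u w ≡ true → adj G w v ≡ true → Empty) → (R : Walk G u v) → 3 ≤ len R
  noCommonNeighbour⇒3≤len u≢v uv∉G no-w (nil _)                      = ⊥-elim (u≢v refl)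
  noCommonNeighbour⇒3≤len u≢v uv∉G no-w (cons h (nil _))             with trans (sym h) uv∉G
  ... | ()
  noCommonNeighbour⇒3≤len u≢v uv∉G no-w (cons h (cons h′ (nil _)))   = ⊥-elim (no-w _ h h′)
  noCommonNeighbour⇒3≤len u≢v uv∉G no-w (cons _ (cons _ (cons _ _))) = s≤s (s≤s (s≤s z≤n))

UniqueMidpoint : ∀ {n} → Graph n → Fin n → Set
UniqueMidpoint {n} G x = Σ[ u ∈ Fin n ] Σ[ v ∈ Fin n ]
  u ≢ v × adj G u v ≡ false × adj G u x ≡ true × adj G x v ≡ true ×
  (∀ w → adj G u w ≡ true × adj G w v ≡ true → w ≡ x)

module _ {n} {G : Graph n} where

  unique-midpoint-∉ : ∀ {x X} → UniqueMidpoint G x → IsTotalMutualVisibility G X → x ∉ X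
  unique-midpoint-∉ {x} {X} (u , v , u≢v , uv∉G , ux , xv , unique) tmv x∈X
    with tmv u v
  ... | P , P-short , P-avoids = via P P-short P-avoids
    where
    via : (P : Walk G u v) → IsShortest P → InternallyAvoids X P → Empty
    via (nil _)                        _       _        = u≢v refl
    via (cons h (nil _))               _       _        with trans (sym h) uv∉G
    ... | ()
    via (cons {w = w} h (cons h′ (nil _))) _   P-avoids with unique w (h , h′)
    ... | refl with P-avoids x (Any.there (Any.here refl)) x∈X
    ...   | inj₁ x≡u = adj⇒≢ G ux (sym x≡u)
    ...   | inj₂ x≡v = adj⇒≢ G xv x≡v
    via (cons _ (cons _ (cons _ _)))   P-short _        with P-short (cons ux (cons xv (nil v)))
    ... | s≤s (s≤s ())

  isMuT-by-midpoints : ∀ {Z} → IsTotalMutualVisibility G Z → (∀ x → x ∉ Z → UniqueMidpoint G x) →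
                       IsMuT G ∣ Z ∣
  isMuT-by-midpoints {Z} Z-tmv midpoint = (Z , Z-tmv , refl) , λ X X-tmv → p⊆q⇒∣p∣≤∣q∣ (X⊆Z X-tmv)
    where
    X⊆Z : ∀ {X} → IsTotalMutualVisibility G X → ∀ {x} → x ∈ X → x ∈ Z
    X⊆Z X-tmv {x} x∈X with x ∈? Z
    ... | yes x∈Z = x∈Z
    ... | no  x∉Z = ⊥-elim (unique-midpoint-∉ (midpoint x x∉Z) X-tmv x∈X)

uniqueMidpoint? : ∀ {n} (G : Graph n) x → Dec (UniqueMidpoint G x)
uniqueMidpoint? G x = any? λ u → any? λ v →
  ¬? (u ≟ v) ×-dec (adj G u v Bool.≟ false) ×-dec (adj G u x Bool.≟ true) ×-dec (adj G x v Bool.≟ true) ×-dec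
  all? (λ w → ((adj G u w Bool.≟ true) ×-dec (adj G w v Bool.≟ true)) →-dec (w ≟ x))

-- d u v is meant to be the distance from u to v: descending along d then gives geodesics
-- whose interior avoids X.
module VisibilityCertificate {n} (G : Graph n) (X : Subset n) (d : Fin n → Fin n → ℕ) where

  DescentStep : Fin n → Fin n → Set
  DescentStep u v = ∃[ w ] adj G u w ≡ true × suc (d w v) ≡ d u v × (w ∈ X → w ≡ v)

  IsCertificate : Set
  IsCertificate = (∀ v → IsPotential {G = G} (λ x → d x v)) × (∀ v → d v v ≡ 0) ×
                  (∀ u v → u ≢ v → DescentStep u v)

  isCertificate? : Dec IsCertificate
  isCertificate? =
    all? (λ v → all? λ x → all? λ y → (adj G x y Bool.≟ true) →-dec (d x v ℕ.≤? suc (d y v)))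
    ×-dec all? (λ v → d v v ℕ.≟ 0)
    ×-dec all? (λ u → all? λ v → ¬? (u ≟ v) →-dec any? λ w →
            (adj G u w Bool.≟ true) ×-dec (suc (d w v) ℕ.≟ d u v) ×-dec ((w ∈? X) →-dec (w ≟ v)))

  module _ (cert : IsCertificate) where

    private
      d-potential = proj₁ cert
      d-vanishes  = proj₁ (proj₂ cert)
      d-step      = proj₂ (proj₂ cert)

    descend : ∀ k u v → d u v ≡ k → Σ (Walk G u v) λ P → len P ≡ d u v × InternallyAvoids X P
    descend k u v duv≡k with u ≟ v
    ... | yes refl = nil u , sym (d-vanishes u) , avoids-nil G u
    ... | no u≢v with d-step u v u≢v
    descend zero    u v duv≡0 | no _ | w , _ , 1+dwv≡duv , _ with trans 1+dwv≡duv duv≡0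
    ... | ()
    descend (suc k) u v duv≡k | no _ | w , uw , 1+dwv≡duv , w-ok
      with descend k w v (suc-injective (trans 1+dwv≡duv duv≡k))
    ... | P , lenP≡dwv , P-avoids =
      cons uw P , trans (cong suc lenP≡dwv) 1+dwv≡duv , avoids-cons G uw P w-ok P-avoids

    certificate⇒tmv : IsTotalMutualVisibility G X
    certificate⇒tmv u v with descend _ u v refl
    ... | P , lenP≡duv , P-avoids = P , P-short , P-avoids
      where
      P-short : IsShortest P
      P-short R = begin
        len P        ≡⟨ lenP≡duv ⟩
        d u v        ≤⟨ potential≤len (d-potential v) R ⟩
        len R + d v v ≡⟨ cong (λ i → len R + i) (d-vanishes v) ⟩
        len R + 0    ≡⟨ +-identityʳ _ ⟩
        len R        ∎
        where open ≤-Reasoning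

module EdgeDeletion {n} (G : Graph n) (a b : Fin n) (ab∈G : adj G a b ≡ true) where

  H : Graph n
  H = G -edge a , b

  IsDeleted : Fin n → Fin n → Set
  IsDeleted s t = (s ≡ a × t ≡ b) ⊎ (s ≡ b × t ≡ a)

  H⊆G : ∀ {x y} → adj H x y ≡ true → adj G x y ≡ true
  H⊆G {x} {y} = ∧-conicalˡ (adj G x y) _

  deleted∈G : ∀ {s t} → IsDeleted s t → adj G s t ≡ true
  deleted∈G (inj₁ (refl , refl)) = ab∈G
  deleted∈G (inj₂ (refl , refl)) = trans (adj-sym G b a) ab∈G

  G⊆H⊎deleted : ∀ {x y} → adj G x y ≡ true → IsDeleted x y ⊎ adj H x y ≡ true
  G⊆H⊎deleted {x} {y} h with adj G x y | x ≟ a | y ≟ b | x ≟ b | y ≟ a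
  ... | true | yes x≡a | yes y≡b | _       | _       = inj₁ (inj₁ (x≡a , y≡b))
  ... | true | _       | _       | yes x≡b | yes y≡a = inj₁ (inj₂ (x≡b , y≡a))
  ... | true | no _    | _       | no _    | _       = inj₂ refl
  ... | true | no _    | _       | yes _   | no _    = inj₂ refl
  ... | true | yes _   | no _    | no _    | _       = inj₂ refl
  ... | true | yes _   | no _    | yes _   | no _    = inj₂ refl

  deleted-pairs : ∀ {s t s′ t′} → IsDeleted s t → IsDeleted s′ t′ →
                  (s′ ≡ t × t′ ≡ s) ⊎ (s′ ≡ s × t′ ≡ t)
  deleted-pairs (inj₁ (refl , refl)) (inj₁ (refl , refl)) = inj₂ (refl , refl)
  deleted-pairs (inj₁ (refl , refl)) (inj₂ (refl , refl)) = inj₁ (refl , refl)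
  deleted-pairs (inj₂ (refl , refl)) (inj₁ (refl , refl)) = inj₁ (refl , refl)
  deleted-pairs (inj₂ (refl , refl)) (inj₂ (refl , refl)) = inj₂ (refl , refl)

  liftʷ : ∀ {u v} → Walk H u v → Walk G u v
  liftʷ = mapʷ H⊆G

  LiftsToH : ∀ {u v} → Walk G u v → Set
  LiftsToH {u} {v} P = Σ (Walk H u v) λ P′ → len P′ ≡ len P

  SplitAtDeleted : Graph n → ∀ {u v} → Walk G u v → Set
  SplitAtDeleted K {u} {v} P = Σ[ s ∈ Fin n ] Σ[ t ∈ Fin n ] IsDeleted s t ×
    Σ (Walk K u s) λ P₁ → Σ (Walk H t v) λ P₂ → len P ≡ len P₁ + suc (len P₂)

  lastCrossing : ∀ {u v} (P : Walk G u v) → LiftsToH P ⊎ SplitAtDeleted G P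
  lastCrossing (nil u) = inj₁ (nil u , refl)
  lastCrossing (cons {u} {w} h P) with lastCrossing P
  ... | inj₂ (s , t , st , P₁ , P₂ , eq) = inj₂ (s , t , st , cons h P₁ , P₂ , cong suc eq)
  ... | inj₁ (P′ , eq) with G⊆H⊎deleted h
  ...   | inj₁ uw = inj₂ (u , w , uw , nil u , P′ , cong suc (sym eq))
  ...   | inj₂ h′ = inj₁ (cons h′ P′ , cong suc eq)

  -- A second crossing of the deleted edge could be cut out of a geodesic.
  geodesic-split : ∀ {u v} (P : Walk G u v) → IsShortest P → LiftsToH P ⊎ SplitAtDeleted H P
  geodesic-split P P-short with lastCrossing P
  ... | inj₁ P-lifts = inj₁ P-lifts
  ... | inj₂ (s , t , st , P₁ , P₂ , P≡P₁stP₂) with lastCrossing P₁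
  ...   | inj₁ (P₁′ , P₁′≡P₁) =
    inj₂ (s , t , st , P₁′ , P₂ , trans P≡P₁stP₂ (cong (_+ suc (len P₂)) (sym P₁′≡P₁)))
  ...   | inj₂ (s′ , t′ , s′t′ , R₁ , R₂ , P₁≡R₁s′t′R₂) =
    ⊥-elim (<⇒≱ (≤-<-trans (shortcut-len c) R₁stP₂<P) (P-short (shortcut c)))
    where
    c = deleted-pairs st s′t′
    R₁stP₂<P : len R₁ + suc (len P₂) < len P
    R₁stP₂<P = subst (_ <_) (sym P≡P₁stP₂)
      (+-monoˡ-< (suc (len P₂)) (subst (len R₁ <_) (sym P₁≡R₁s′t′R₂) (m<m+n (len R₁) (s≤s z≤n))))
    shortcut : (s′ ≡ t × t′ ≡ s) ⊎ (s′ ≡ s × t′ ≡ t) → Walk G _ _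
    shortcut (inj₁ (refl , refl)) = R₁ ++ʷ liftʷ P₂
    shortcut (inj₂ (refl , refl)) = R₁ ++ʷ cons (deleted∈G st) (liftʷ P₂)
    shortcut-len : ∀ c → len (shortcut c) ≤ len R₁ + suc (len P₂)
    shortcut-len (inj₁ (refl , refl)) =
      ≤-trans (≤-reflexive (trans (len-++ʷ R₁ _) (cong (λ i → len R₁ + i) (len-mapʷ H⊆G P₂))))
              (+-monoʳ-≤ (len R₁) (n≤1+n _))
    shortcut-len (inj₂ (refl , refl)) =
      ≤-reflexive (trans (len-++ʷ R₁ _) (cong (λ i → len R₁ + suc i) (len-mapʷ H⊆G P₂)))

  module _ {X : Subset n} where

    X-a-b⊆X : X - a - b ⊆ X
    X-a-b⊆X = p─q⊆p X ⁅ a ⁆ ∘ p─q⊆p (X - a) ⁅ b ⁆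

    a∉X-a-b : a ∉ X - a - b
    a∉X-a-b = x∉p-x X a ∘ p─q⊆p (X - a) ⁅ b ⁆

    b∉X-a-b : b ∉ X - a - b
    b∉X-a-b = x∉p-x (X - a) b

    deleted∉X-a-b : ∀ {s t} → IsDeleted s t → s ∉ X - a - b × t ∉ X - a - b
    deleted∉X-a-b (inj₁ (refl , refl)) = a∉X-a-b , b∉X-a-b
    deleted∉X-a-b (inj₂ (refl , refl)) = b∉X-a-b , a∉X-a-b

  tmv-G-without-ends : HasGeodesics G → ∀ {X} → IsTotalMutualVisibility H X →
                       IsTotalMutualVisibility G (X - a - b)
  tmv-G-without-ends geodesics {X} tmv u v with geodesics u v
  ... | P , P-short with geodesic-split P P-short
  ...   | inj₁ (P′ , P′≡P) with tmv u v
  ...     | Q , Q-short , Q-avoids = liftʷ Q , lifted-short , avoids-⊆ X-a-b⊆X (avoids-mapʷ H⊆G Q-avoids)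
    where
    lifted-short : IsShortest (liftʷ Q)
    lifted-short R = begin
      len (liftʷ Q) ≡⟨ len-mapʷ H⊆G Q ⟩
      len Q         ≤⟨ Q-short P′ ⟩
      len P′        ≡⟨ P′≡P ⟩
      len P         ≤⟨ P-short R ⟩
      len R         ∎
      where open ≤-Reasoning
  tmv-G-without-ends geodesics {X} tmv u v | P , P-short | inj₂ (s , t , st , P₁ , P₂ , P≡P₁stP₂)
    with tmv u s | tmv t v
  ... | Q₁ , Q₁-short , Q₁-avoids | Q₂ , Q₂-short , Q₂-avoids = W , W-short , W-avoids
    where
    W : Walk G u v
    W = liftʷ Q₁ ++ʷ cons (deleted∈G st) (liftʷ Q₂)
    W-short : IsShortest W
    W-short R = begin
      len W                                 ≡⟨ len-++ʷ (liftʷ Q₁) _ ⟩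
      len (liftʷ Q₁) + suc (len (liftʷ Q₂)) ≡⟨ cong₂ (λ i j → i + suc j) (len-mapʷ H⊆G Q₁) (len-mapʷ H⊆G Q₂) ⟩
      len Q₁ + suc (len Q₂)                 ≤⟨ +-mono-≤ (Q₁-short P₁) (s≤s (Q₂-short P₂)) ⟩
      len P₁ + suc (len P₂)                 ≡⟨ P≡P₁stP₂ ⟨
      len P                                 ≤⟨ P-short R ⟩
      len R                                 ∎
      where open ≤-Reasoning
    W-avoids : InternallyAvoids (X - a - b) W
    W-avoids = avoids-++ʷ s∉ (avoids-⊆ X-a-b⊆X (avoids-mapʷ H⊆G Q₁-avoids))
      (avoids-cons G (deleted∈G st) (liftʷ Q₂) (⊥-elim ∘ t∉) (avoids-⊆ X-a-b⊆X (avoids-mapʷ H⊆G Q₂-avoids)))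
      where open Σ (deleted∉X-a-b st) renaming (proj₁ to s∉; proj₂ to t∉)

  μt-delete-edge-≤ : ∀ {k k′} → IsMuT G k → IsMuT H k′ → k′ ≤ k + 2
  μt-delete-edge-≤ {k} ((_ , tmv₀ , _) , G-max) ((X , tmv , refl) , _) = begin
    ∣ X ∣                 ≤⟨ ∣p∣≤∣p-x∣+1 X a ⟩
    ∣ X - a ∣ + 1         ≤⟨ +-monoˡ-≤ 1 (∣p∣≤∣p-x∣+1 (X - a) b) ⟩
    ∣ X - a - b ∣ + 1 + 1 ≤⟨ +-monoˡ-≤ 1 (+-monoˡ-≤ 1 (G-max _ (tmv-G-without-ends (tmv⇒hasGeodesics tmv₀) tmv))) ⟩
    k + 1 + 1             ≡⟨ +-assoc k 1 1 ⟩
    k + 2                 ∎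
    where open ≤-Reasoning

cyclicSuccessor? cycleAdj : Fin 5 → Fin 5 → Bool
cyclicSuccessor? u v = (toℕ u + 1) % 5 ≡ᵇ toℕ v
cycleAdj u v = cyclicSuccessor? u v ∨ cyclicSuccessor? v u

C₅ : Graph 5
C₅ = record
  { adj        = cycleAdj
  ; adj-sym    = λ u v → ∨-comm (cyclicSuccessor? u v) (cyclicSuccessor? v u)
  ; adj-irrefl = from-yes (all? λ u → cycleAdj u u Bool.≟ false)
  }

P₅ : Graph 5
P₅ = C₅ -edge (# 0) , (# 4)

cycleDist pathDist : Fin 5 → Fin 5 → ℕ
cycleDist x v = ℕ.∣ toℕ x - toℕ v ∣ ⊓ (5 ∸ ℕ.∣ toℕ x - toℕ v ∣)
pathDist  x v = ℕ.∣ toℕ x - toℕ v ∣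

leaves : Subset 5
leaves = inside ∷ outside ∷ outside ∷ outside ∷ inside ∷ []

module C₅-certificate = VisibilityCertificate C₅ ⊥ cycleDist
module P₅-certificate = VisibilityCertificate P₅ leaves pathDist

C₅-μt : IsMuT C₅ 0
C₅-μt = isMuT-by-midpoints
  (C₅-certificate.certificate⇒tmv (from-yes C₅-certificate.isCertificate?))
  (from-yes (all? λ x → ¬? (x ∈? ⊥) →-dec uniqueMidpoint? C₅ x))

P₅-μt : IsMuT P₅ 2
P₅-μt = isMuT-by-midpoints
  (P₅-certificate.certificate⇒tmv (from-yes P₅-certificate.isCertificate?))
  (from-yes (all? λ x → ¬? (x ∈? leaves) →-dec uniqueMidpoint? P₅ x))

≟-true⇒≡ : ∀ {m} {i j : Fin m} → ⌊ i ≟ j ⌋ ≡ true → i ≡ j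
≟-true⇒≡ h = toWitness (Equivalence.from T-≡ h)

≟-refl : ∀ {m} (i : Fin m) → ⌊ i ≟ i ⌋ ≡ true
≟-refl i with i ≟ i
... | yes _   = refl
... | no i≢i = ⊥-elim (i≢i refl)

data BookVertex (m : ℕ) : Set where
  A B : BookVertex m
  X Y : Fin m → BookVertex m

module BookGraph (m : ℕ) where

  book : BookVertex m → BookVertex m → Bool
  book A     B     = true
  book B     A     = true
  book A     (X _) = true
  book (X _) A     = true
  book B     (Y _) = true
  book (Y _) B     = true
  book (X i) (Y j) = ⌊ i ≟ j ⌋
  book (Y j) (X i) = ⌊ i ≟ j ⌋   -- X-index first, so that book-sym holds by refl
  book _     _     = false

  book-sym : ∀ c d → book c d ≡ book d c
  book-sym A     A     = refl
  book-sym A     B     = refl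
  book-sym A     (X _) = refl
  book-sym A     (Y _) = refl
  book-sym B     A     = refl
  book-sym B     B     = refl
  book-sym B     (X _) = refl
  book-sym B     (Y _) = refl
  book-sym (X _) A     = refl
  book-sym (X _) B     = refl
  book-sym (X _) (X _) = refl
  book-sym (X _) (Y _) = refl
  book-sym (Y _) A     = refl
  book-sym (Y _) B     = refl
  book-sym (Y _) (X _) = refl
  book-sym (Y _) (Y _) = refl

  book-irrefl : ∀ c → book c c ≡ false
  book-irrefl A     = refl
  book-irrefl B     = refl
  book-irrefl (X _) = refl
  book-irrefl (Y _) = refl

  isA isB : BookVertex m → Bool
  isA A = true
  isA _ = false
  isB B = true
  isB _ = false

  spine? : BookVertex m → BookVertex m → Bool
  spine? c d = (isA c ∧ isB d) ∨ (isB c ∧ isA d)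

  -- Spine test first: book⁻ then reduces on every pair of constructors.
  book⁻ : BookVertex m → BookVertex m → Bool
  book⁻ c d = not (spine? c d) ∧ book c d

  decode : Fin (2 + (m + m)) → BookVertex m
  decode zero          = A
  decode (suc zero)    = B
  decode (suc (suc w)) = [ X , Y ]′ (splitAt m w)

  encode : BookVertex m → Fin (2 + (m + m))
  encode A     = zero
  encode B     = suc zero
  encode (X i) = suc (suc (i ↑ˡ m))
  encode (Y i) = suc (suc (m ↑ʳ i))

  decode-encode : ∀ c → decode (encode c) ≡ c
  decode-encode A     = refl
  decode-encode B     = refl
  decode-encode (X i) = cong [ X , Y ]′ (splitAt-↑ˡ m i m)
  decode-encode (Y i) = cong [ X , Y ]′ (splitAt-↑ʳ m m i)

  encode-decode : ∀ u → encode (decode u) ≡ u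
  encode-decode zero          = refl
  encode-decode (suc zero)    = refl
  encode-decode (suc (suc w)) = trans (encode-page (splitAt m w)) (cong (λ w′ → suc (suc w′)) (join-splitAt m m w))
    where
    encode-page : ∀ s → encode ([ X , Y ]′ s) ≡ suc (suc (join m m s))
    encode-page (inj₁ i) = refl
    encode-page (inj₂ i) = refl

  encode-injective : ∀ {c d} → encode c ≡ encode d → c ≡ d
  encode-injective {c} {d} e = trans (sym (decode-encode c)) (trans (cong decode e) (decode-encode d))

  encode-≢ : ∀ {c d} → c ≢ d → encode c ≢ encode d
  encode-≢ c≢d = c≢d ∘ encode-injective

  _≟ᵛ_ : (c d : BookVertex m) → Dec (c ≡ d)
  c ≟ᵛ d = map′ encode-injective (cong encode) (encode c ≟ encode d)

  Book : Graph (2 + (m + m))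
  Book = record
    { adj        = λ u v → book (decode u) (decode v)
    ; adj-sym    = λ u v → book-sym (decode u) (decode v)
    ; adj-irrefl = λ u → book-irrefl (decode u)
    }

  Book⁻ : Graph (2 + (m + m))
  Book⁻ = Book -edge zero , suc zero

  isA-decode : ∀ u → ⌊ u ≟ zero ⌋ ≡ isA (decode u)
  isA-decode zero          = refl
  isA-decode (suc zero)    = refl
  isA-decode (suc (suc w)) with splitAt m w
  ... | inj₁ _ = refl
  ... | inj₂ _ = refl

  isB-decode : ∀ u → ⌊ u ≟ suc zero ⌋ ≡ isB (decode u)
  isB-decode zero          = refl
  isB-decode (suc zero)    = refl
  isB-decode (suc (suc w)) with splitAt m w
  ... | inj₁ _ = refl
  ... | inj₂ _ = refl

  Book⁻-adj : ∀ u v → adj Book⁻ u v ≡ book⁻ (decode u) (decode v)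
  Book⁻-adj u v = trans (∧-comm (book (decode u) (decode v)) _)
    (cong (λ e → not e ∧ book (decode u) (decode v))
      (cong₂ _∨_ (cong₂ _∧_ (isA-decode u) (isB-decode v)) (cong₂ _∧_ (isB-decode u) (isA-decode v))))

  module OnBookVertices (K : BookVertex m → BookVertex m → Bool) (Gr : Graph (2 + (m + m)))
                        (Gr-adj : ∀ u v → adj Gr u v ≡ K (decode u) (decode v)) where

    NoCommonNeighbour : BookVertex m → BookVertex m → Set
    NoCommonNeighbour c d = ∀ e → K c e ≡ true → K e d ≡ true → Empty

    adj-encodeˡ : ∀ c w → adj Gr (encode c) w ≡ K c (decode w)
    adj-encodeˡ c w = trans (Gr-adj _ w) (cong (λ c′ → K c′ (decode w)) (decode-encode c))

    adj-encodeʳ : ∀ w d → adj Gr w (encode d) ≡ K (decode w) d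
    adj-encodeʳ w d = trans (Gr-adj w _) (cong (K (decode w)) (decode-encode d))

    adj-encode : ∀ c d → adj Gr (encode c) (encode d) ≡ K c d
    adj-encode c d = trans (adj-encodeˡ c (encode d)) (cong (K c) (decode-encode d))

    edge : ∀ {c d} → K c d ≡ true → adj Gr (encode c) (encode d) ≡ true
    edge {c} {d} h = trans (adj-encode c d) h

    module _ {Z : Subset (2 + (m + m))} where

      visible-edge : ∀ {c d} → c ≢ d → K c d ≡ true → Visible Gr Z (encode c) (encode d)
      visible-edge c≢d cd =
        cons (edge cd) (nil _) , ≢⇒1≤len Gr (encode-≢ c≢d) , avoids-edge Gr (edge cd)

      visible-via : ∀ {c d} e → encode e ∉ Z → c ≢ d → K c d ≡ false →
                    K c e ≡ true → K e d ≡ true → Visible Gr Z (encode c) (encode d)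
      visible-via e e∉Z c≢d cd ce ed =
        cons (edge ce) Q ,
        nonadjacent⇒2≤len Gr (encode-≢ c≢d) (trans (adj-encode _ _) cd) ,
        avoids-cons Gr (edge ce) Q (⊥-elim ∘ e∉Z) (avoids-edge Gr (edge ed))
        where Q = cons (edge ed) (nil _)

      visible-via₂ : ∀ {c d} e f → encode e ∉ Z → encode f ∉ Z → c ≢ d → K c d ≡ false →
                     NoCommonNeighbour c d → K c e ≡ true → K e f ≡ true → K f d ≡ true →
                     Visible Gr Z (encode c) (encode d)
      visible-via₂ {c} {d} e f e∉Z f∉Z c≢d cd no-common ce ef fd =
        cons (edge ce) Q ,
        noCommonNeighbour⇒3≤len Gr (encode-≢ c≢d) (trans (adj-encode _ _) cd)
          (λ w h h′ → no-common (decode w) (trans (sym (adj-encodeˡ c w)) h) (trans (sym (adj-encodeʳ w d)) h′)) ,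
        avoids-cons Gr (edge ce) Q (⊥-elim ∘ e∉Z) (avoids-cons Gr (edge ef) R (⊥-elim ∘ f∉Z) (avoids-edge Gr (edge fd)))
        where
        R = cons (edge fd) (nil _)
        Q = cons (edge ef) R

      tmv-by-nonadjacent-pairs : (∀ c d → c ≢ d → K c d ≡ false → Visible Gr Z (encode c) (encode d)) →
                       IsTotalMutualVisibility Gr Z
      tmv-by-nonadjacent-pairs visible-nonadjacent u v =
        subst₂ (Visible Gr Z) (encode-decode u) (encode-decode v) (visible (decode u) (decode v))
        where
        visible : ∀ c d → Visible Gr Z (encode c) (encode d)
        visible c d with c ≟ᵛ d
        ... | yes refl = nil _ , (λ _ → z≤n) , avoids-nil Gr (encode c)
        ... | no c≢d with K c d in cd
        ...   | true  = visible-edge c≢d cd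
        ...   | false = visible-nonadjacent c d c≢d cd

    uniqueMidpoint : ∀ c x d → c ≢ d → K c d ≡ false → K c x ≡ true → K x d ≡ true →
                     (∀ e → K c e ≡ true → K e d ≡ true → e ≡ x) → UniqueMidpoint Gr (encode x)
    uniqueMidpoint c x d c≢d cd cx xd unique =
      encode c , encode d , encode-≢ c≢d , trans (adj-encode c d) cd , edge cx , edge xd ,
      λ w (h , h′) → trans (sym (encode-decode w))
        (cong encode (unique (decode w) (trans (sym (adj-encodeˡ c w)) h) (trans (sym (adj-encodeʳ w d)) h′)))

  pages : Subset (2 + (m + m))
  pages = outside ∷ outside ∷ ⊤

  A∉pages : encode A ∉ pages
  A∉pages ()

  B∉pages : encode B ∉ pages
  B∉pages (there ())

  module OnBook = OnBookVertices book Book (λ _ _ → refl)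
  open OnBook using (NoCommonNeighbour)

  X-Y-noCommonNeighbour : ∀ i j → NoCommonNeighbour (X i) (Y j)
  X-Y-noCommonNeighbour i j A     _  ()
  X-Y-noCommonNeighbour i j B     () _
  X-Y-noCommonNeighbour i j (X _) () _
  X-Y-noCommonNeighbour i j (Y _) _  ()

  Y-X-noCommonNeighbour : ∀ i j → NoCommonNeighbour (Y i) (X j)
  Y-X-noCommonNeighbour i j A     () _
  Y-X-noCommonNeighbour i j B     _  ()
  Y-X-noCommonNeighbour i j (X _) _  ()
  Y-X-noCommonNeighbour i j (Y _) () _

  pages-tmv : IsTotalMutualVisibility Book pages
  pages-tmv = OnBook.tmv-by-nonadjacent-pairs visible
    where
    open OnBook
    visible : ∀ c d → c ≢ d → book c d ≡ false → Visible Book pages (encode c) (encode d)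
    visible A     A     c≢d _  = ⊥-elim (c≢d refl)
    visible A     (Y _) c≢d cd = visible-via B B∉pages c≢d cd refl refl
    visible B     B     c≢d _  = ⊥-elim (c≢d refl)
    visible B     (X _) c≢d cd = visible-via A A∉pages c≢d cd refl refl
    visible (X _) B     c≢d cd = visible-via A A∉pages c≢d cd refl refl
    visible (X _) (X _) c≢d cd = visible-via A A∉pages c≢d cd refl refl
    visible (X i) (Y j) c≢d cd = visible-via₂ A B A∉pages B∉pages c≢d cd (X-Y-noCommonNeighbour i j) refl refl refl
    visible (Y _) A     c≢d cd = visible-via B B∉pages c≢d cd refl refl
    visible (Y i) (X j) c≢d cd = visible-via₂ B A B∉pages A∉pages c≢d cd (Y-X-noCommonNeighbour i j) refl refl refl
    visible (Y _) (Y _) c≢d cd = visible-via B B∉pages c≢d cd refl refl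

  module _ {i i′ : Fin m} (i≢i′ : i ≢ i′) where

    X-≢ : X i ≢ X i′
    X-≢ refl = i≢i′ refl

    Y-≢ : Y i ≢ Y i′
    Y-≢ refl = i≢i′ refl

    X-X-commonNeighbour≡A : ∀ e → book (X i) e ≡ true → book e (X i′) ≡ true → e ≡ A
    X-X-commonNeighbour≡A A     _ _  = refl
    X-X-commonNeighbour≡A (Y k) h h′ = ⊥-elim (i≢i′ (trans (≟-true⇒≡ h) (sym (≟-true⇒≡ h′))))

    Y-Y-commonNeighbour≡B : ∀ e → book (Y i) e ≡ true → book e (Y i′) ≡ true → e ≡ B
    Y-Y-commonNeighbour≡B B     _ _  = refl
    Y-Y-commonNeighbour≡B (X k) h h′ = ⊥-elim (i≢i′ (trans (sym (≟-true⇒≡ h)) (≟-true⇒≡ h′)))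

    μt-Book : IsMuT Book (m + m)
    μt-Book = subst (IsMuT Book) (∣⊤∣≡n (m + m)) (isMuT-by-midpoints pages-tmv midpoint)
      where
      midpoint : ∀ x → x ∉ pages → UniqueMidpoint Book x
      midpoint zero          _ = OnBook.uniqueMidpoint (X i) A (X i′) X-≢ refl refl refl X-X-commonNeighbour≡A
      midpoint (suc zero)    _ = OnBook.uniqueMidpoint (Y i) B (Y i′) Y-≢ refl refl refl Y-Y-commonNeighbour≡B
      midpoint (suc (suc w)) w∉pages = ⊥-elim (w∉pages (there (there ∈⊤)))

  module OnBook⁻ = OnBookVertices book⁻ Book⁻ Book⁻-adj

  book⁻⊆book : ∀ c d → book⁻ c d ≡ true → book c d ≡ true
  book⁻⊆book c d = ∧-conicalʳ (not (spine? c d)) (book c d)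

  A-B-noCommonNeighbour⁻ : OnBook⁻.NoCommonNeighbour A B
  A-B-noCommonNeighbour⁻ A     () _
  A-B-noCommonNeighbour⁻ B     () _
  A-B-noCommonNeighbour⁻ (X _) _  ()
  A-B-noCommonNeighbour⁻ (Y _) () _

  B-A-noCommonNeighbour⁻ : OnBook⁻.NoCommonNeighbour B A
  B-A-noCommonNeighbour⁻ A     () _
  B-A-noCommonNeighbour⁻ B     () _
  B-A-noCommonNeighbour⁻ (X _) () _
  B-A-noCommonNeighbour⁻ (Y _) _  ()

  empty-tmv⁻ : Fin m → IsTotalMutualVisibility Book⁻ ⊥
  empty-tmv⁻ i₀ = OnBook⁻.tmv-by-nonadjacent-pairs visible
    where
    open OnBook⁻
    visible : ∀ c d → c ≢ d → book⁻ c d ≡ false → Visible Book⁻ ⊥ (encode c) (encode d)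
    visible A     A     c≢d _  = ⊥-elim (c≢d refl)
    visible A     B     c≢d cd = visible-via₂ (X i₀) (Y i₀) ∉⊥ ∉⊥ c≢d cd A-B-noCommonNeighbour⁻ refl (≟-refl i₀) refl
    visible A     (Y i) c≢d cd = visible-via (X i) ∉⊥ c≢d cd refl (≟-refl i)
    visible B     A     c≢d cd = visible-via₂ (Y i₀) (X i₀) ∉⊥ ∉⊥ c≢d cd B-A-noCommonNeighbour⁻ refl (≟-refl i₀) refl
    visible B     B     c≢d _  = ⊥-elim (c≢d refl)
    visible B     (X i) c≢d cd = visible-via (Y i) ∉⊥ c≢d cd refl (≟-refl i)
    visible (X i) B     c≢d cd = visible-via (Y i) ∉⊥ c≢d cd (≟-refl i) refl
    visible (X _) (X _) c≢d cd = visible-via A ∉⊥ c≢d cd refl refl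
    visible (X i) (Y j) c≢d cd = visible-via₂ A (X j) ∉⊥ ∉⊥ c≢d cd
      (λ e h h′ → X-Y-noCommonNeighbour i j e (book⁻⊆book (X i) e h) (book⁻⊆book e (Y j) h′)) refl refl (≟-refl j)
    visible (Y i) A     c≢d cd = visible-via (X i) ∉⊥ c≢d cd (≟-refl i) refl
    visible (Y i) (X j) c≢d cd = visible-via₂ B (Y j) ∉⊥ ∉⊥ c≢d cd
      (λ e h h′ → Y-X-noCommonNeighbour i j e (book⁻⊆book (Y i) e h) (book⁻⊆book e (X j) h′)) refl refl (≟-refl j)
    visible (Y _) (Y _) c≢d cd = visible-via B ∉⊥ c≢d cd refl refl

  A-Y-commonNeighbour⁻≡X : ∀ i e → book⁻ A e ≡ true → book⁻ e (Y i) ≡ true → e ≡ X i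
  A-Y-commonNeighbour⁻≡X i (X k) _ h = cong X (≟-true⇒≡ h)

  X-B-commonNeighbour⁻≡Y : ∀ i e → book⁻ (X i) e ≡ true → book⁻ e B ≡ true → e ≡ Y i
  X-B-commonNeighbour⁻≡Y i (Y k) h _ = cong Y (sym (≟-true⇒≡ h))

  μt-Book⁻ : ∀ {i i′ : Fin m} → i ≢ i′ → IsMuT Book⁻ 0
  μt-Book⁻ {i} {i′} i≢i′ = subst (IsMuT Book⁻) (∣⊥∣≡0 (2 + (m + m))) (isMuT-by-midpoints (empty-tmv⁻ i) midpoint)
    where
    open OnBook⁻
    midpoint′ : ∀ c → UniqueMidpoint Book⁻ (encode c)
    midpoint′ A     = uniqueMidpoint (X i) A (X i′) (X-≢ i≢i′) refl refl refl
                        (λ e h h′ → X-X-commonNeighbour≡A i≢i′ e (book⁻⊆book (X i) e h) (book⁻⊆book e (X i′) h′))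
    midpoint′ B     = uniqueMidpoint (Y i) B (Y i′) (Y-≢ i≢i′) refl refl refl
                        (λ e h h′ → Y-Y-commonNeighbour≡B i≢i′ e (book⁻⊆book (Y i) e h) (book⁻⊆book e (Y i′) h′))
    midpoint′ (X j) = uniqueMidpoint A (X j) (Y j) (λ ()) refl refl (≟-refl j) (A-Y-commonNeighbour⁻≡X j)
    midpoint′ (Y j) = uniqueMidpoint (X j) (Y j) B (λ ()) refl (≟-refl j) refl (X-B-commonNeighbour⁻≡Y j)
    midpoint : ∀ x → x ∉ ⊥ → UniqueMidpoint Book⁻ x
    midpoint x _ = subst (UniqueMidpoint Book⁻) (encode-decode x) (midpoint′ (decode x))

toℚᵘ-[k/1] : ∀ k → toℚᵘ (+ k / 1) ℚᵘ.≃ ℚᵘ.mkℚᵘ (+ k) 0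
toℚᵘ-[k/1] k = ℚᵘ.*≡* (begin
  ℚᵘ.↥ toℚᵘ (+ k / 1) *ℤ + 1 ≡⟨ ℤ.*-identityʳ _ ⟩
  ℚᵘ.↥ toℚᵘ (+ k / 1)        ≡⟨ ℚ.↥ᵘ-toℚᵘ (+ k / 1) ⟩
  ↥ (+ k / 1)               ≡⟨ cancel-gcd ↥_ (ℚ.↥-/ (+ k) 1) ⟩
  + k                       ≡⟨ ℤ.*-identityʳ (+ k) ⟨
  + k *ℤ + 1                ≡⟨ cong (+ k *ℤ_) (cancel-gcd ↧_ (ℚ.↧-/ (+ k) 1)) ⟨
  + k *ℤ ↧ (+ k / 1)        ≡⟨ cong (+ k *ℤ_) (ℚ.↧ᵘ-toℚᵘ (+ k / 1)) ⟨
  + k *ℤ ℚᵘ.↧ toℚᵘ (+ k / 1) ∎)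
  where
  open ≡-Reasoning
  gcd≡1 : gcdℤ (+ k) (+ 1) ≡ + 1
  gcd≡1 = cong +_ (gcd-zeroʳ k)
  cancel-gcd : ∀ (f : ℚ → ℤ) {i} → f (+ k / 1) *ℤ gcdℤ (+ k) (+ 1) ≡ i → f (+ k / 1) ≡ i
  cancel-gcd f eq = trans (sym (ℤ.*-identityʳ _)) (trans (cong (f (+ k / 1) *ℤ_) (sym gcd≡1)) eq)

dominated-sum-≰0 : ∀ (P d : ℕ) (r : ℤ) → ∣ r ∣ᶻ * suc d < P → ¬ (+ P +ℤ r *ℤ + suc d ≤ℤ + 0)
dominated-sum-≰0 P d (+ r)    rd<P h rewrite ℤ.+◃n≡+n (r * suc d) with h
... | +≤+ P+rd≤0 = <⇒≱ (≤-<-trans z≤n rd<P) (≤-trans (m≤m+n P _) P+rd≤0)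
dominated-sum-≰0 P d -[1+ r ] rd<P h with subst (_≤ℤ + 0) (ℤ.⊖-≥ (<⇒≤ rd<P)) h
... | +≤+ P∸rd≤0 = <⇒≱ (m<n⇒0<n∸m rd<P) P∸rd≤0

toℚᵘ-α[k/1]+β : ∀ α β k → toℚᵘ (α *ℚ (+ k / 1) +ℚ β) ℚᵘ.≃ toℚᵘ α ℚᵘ.* ℚᵘ.mkℚᵘ (+ k) 0 ℚᵘ.+ toℚᵘ β
toℚᵘ-α[k/1]+β α β k = ℚᵘₚ.≃-trans (ℚ.toℚᵘ-homo-+ (α *ℚ (+ k / 1)) β)
  (ℚᵘₚ.+-congˡ (toℚᵘ β) (ℚᵘₚ.≃-trans (ℚ.toℚᵘ-homo-* α (+ k / 1)) (ℚᵘₚ.*-congˡ {toℚᵘ α} (toℚᵘ-[k/1] k))))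

-- With α = (1 + p)/(1 + q) and β = r/(1 + s), clearing denominators turns α (1 + K) + β ≤ 0 into
-- (1 + p)(1 + K)(1 + s) + r (1 + q·1) ≤ 0; the factor 1 + q·1 = (1 + q)·1 is the denominator
-- that ℚᵘ multiplication produces for α (1 + K).
α[1+K]+β-≰0 : ∀ α β → 0ℚ <ℚ α → ∀ K → ∣ ↥ β ∣ᶻ * ↧ₙ α < suc K → ¬ (α *ℚ (+ suc K / 1) +ℚ β ≤ℚ 0ℚ)
α[1+K]+β-≰0 α@(mkℚ +[1+ p ] q _) β@(mkℚ r s _) _ K rq<K h
  with ℚᵘₚ.≤-respˡ-≃ (toℚᵘ-α[k/1]+β α β (suc K)) (ℚ.toℚᵘ-mono-≤ h)
... | ℚᵘ.*≤* cleared = dominated-sum-≰0 _ (q * 1) r rq<P (subst (_≤ℤ + 0) (ℤ.*-identityʳ _) cleared)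
  where
  K<P : suc K ≤ suc p * suc K * suc s
  K<P = ≤-trans (m≤n*m (suc K) (suc p)) (m≤m*n (suc p * suc K) (suc s))
  rq<P : ∣ r ∣ᶻ * suc (q * 1) < suc p * suc K * suc s
  rq<P = <-≤-trans (subst (λ x → ∣ r ∣ᶻ * suc x < suc K) (sym (*-identityʳ q)) rq<K) K<P
α[1+K]+β-≰0 (mkℚ (+ zero) _ _) _ (*<* (+<+ ())) _ _ _
α[1+K]+β-≰0 (mkℚ -[1+ _ ] _ _) _ (*<* ()) _ _ _

LinearLowerBound : ℚ → ℚ → Set
LinearLowerBound α β =
  ∀ (n : ℕ) (G : Graph n) (a b : Fin n) → adj G a b ≡ true →
    Connected G → Connected (G -edge a , b) →
    ∀ k k′ → IsMuT G k → IsMuT (G -edge a , b) k′ → α *ℚ (+ k / 1) +ℚ β ≤ℚ + k′ / 1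

no-linear-lower-bound : ∀ α β → 0ℚ <ℚ α → ¬ LinearLowerBound α β
no-linear-lower-bound α β 0<α lower-bound =
  α[1+K]+β-≰0 α β 0<α _ j<m+m
    (lower-bound _ Book zero (suc zero) refl (isMuT⇒connected μt-G) (isMuT⇒connected μt-G⁻) _ _ μt-G μt-G⁻)
  where
  j = ∣ ↥ β ∣ᶻ * ↧ₙ α
  m = 2 + j
  open BookGraph m
  μt-G = μt-Book {zero} {suc zero} (λ ())
  μt-G⁻ = μt-Book⁻ {zero} {suc zero} (λ ())
  j<m+m : j < m + m
  j<m+m = s≤s (≤-trans (m≤m+n j _) (n≤1+n _))

theorem3p4 : (∀ (n : ℕ) (G : Graph n) (a b : Fin n) → adj G a b ≡ true →
    Connected G → Connected (G -edge a , b) →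
    ∀ k k' → IsMuT G k → IsMuT (G -edge a , b) k' → k' ≤ k + 2)
    ×
    (Σ ℕ λ n → Σ (Graph n) λ G → Σ (Fin n) λ a → Σ (Fin n) λ b →
    adj G a b ≡ true × Connected G × Connected (G -edge a , b) ×
    Σ ℕ λ k → IsMuT G k × IsMuT (G -edge a , b) (k + 2))
    ×
    ¬ (Σ ℚ λ α → Σ ℚ λ β → 0ℚ <ℚ α ×
    (∀ (n : ℕ) (G : Graph n) (a b : Fin n) → adj G a b ≡ true →
    Connected G → Connected (G -edge a , b) →
    ∀ k k' → IsMuT G k → IsMuT (G -edge a , b) k' →
    (α *ℚ (+ k / 1)) +ℚ β ≤ℚ (+ k' / 1)))
theorem3p4 =
  (λ n G a b ab∈G _ _ _ _ → EdgeDeletion.μt-delete-edge-≤ G a b ab∈G) ,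
  (5 , C₅ , # 0 , # 4 , refl , isMuT⇒connected C₅-μt , isMuT⇒connected P₅-μt , 0 , C₅-μt , P₅-μt) ,
  λ (α , β , 0<α , lower-bound) → no-linear-lower-bound α β 0<α lower-bound
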